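{- Let $q$ be a prime power and let $\mathcal{M}$ be a class of simple $GF(q)$-representable matroids that is closed under taking induced restrictions. Let $\widehat{\mathcal{M}}$ be the class consisting of the members of $\mathcal{M}$ together with all matroids obtainable from members of $\mathcal{M}$ by repeatedly taking $q$-conings. Then $\widehat{\mathcal{M}}$ is closed under taking induced restrictions.
   Context: An induced restriction of a matroid $M$ is the restriction of $M$ to a flat of $M$. For a simple $GF(q)$-representable matroid $N$ (viewed as a restriction of a projective geometry over $GF(q)$), its $q$-coning $A(N)$ is obtained by adding a coloop $p$ (the tip) to $N$ and then adding every point on each projective line between $p$ and a point of $N$. -}

module Defs where

open import Level using (0ℓ)
open import Data.Nat using (ℕ; suc)
open import Data.Fin using (Fin)
open import Data.Bool using (Bool; true; false)
open import Data.Maybe using (Maybe; just; nothing)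
open import Data.Product using (Σ; ∃; _×_; _,_; proj₁)
open import Data.List using (List; []; _∷_; map; length)
open import Data.List.Relation.Unary.All using (All)
open import Data.List.Relation.Unary.Unique.Propositional using (Unique)
open import Data.Vec using (Vec; []; _∷_; replicate; zipWith)
open import Function.Bundles using (_↔_; _⇔_; Inverse)
open import Relation.Nullary using (¬_)
open import Relation.Binary.PropositionalEquality using (_≡_; _≢_)
open import Relation.Binary.Definitions using (DecidableEquality)
open import Algebra.Structures using (IsCommutativeRing)

record FiniteField : Set₁ where
  infixl 6 _+_
  infixl 7 _*_
  field
    Carrier : Set
    _+_ _*_ : Carrier → Carrier → Carrier
    -_      : Carrier → Carrier
    0# 1#   : Carrier
    isCommutativeRing : IsCommutativeRing _≡_ _+_ _*_ -_ 0# 1#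
    0≢1     : 0# ≢ 1#
    inverse : ∀ x → x ≢ 0# → ∃ λ y → x * y ≡ 1#
    _≟_     : DecidableEquality Carrier
    finite  : ∃ λ (q : ℕ) → Carrier ↔ Fin q

module _ (F : FiniteField) where
  open FiniteField F

  lincomb : ∀ {r} → List Carrier → List (Vec Carrier r) → Vec Carrier r
  lincomb {r} []       _        = replicate r 0#
  lincomb {r} (_ ∷ _)  []       = replicate r 0#
  lincomb     (c ∷ cs) (v ∷ vs) = zipWith _+_ (Data.Vec.map (c *_) v) (lincomb cs vs)

  LinIndep : ∀ {r} → List (Vec Carrier r) → Set
  LinIndep {r} vs = ∀ (cs : List Carrier) → length cs ≡ length vs →
                    lincomb cs vs ≡ replicate r 0# → All (_≡ 0#) cs

  -- A GF(q)-represented matroid: ground set G, each element a vector of F^r.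
  -- (The matroid is the vector matroid of this family.)
  record RMat : Set₁ where
    field
      G   : Set
      r   : ℕ
      vec : G → Vec Carrier r

  open RMat public

  Indep : (N : RMat) → List (G N) → Set
  Indep N xs = Unique xs × LinIndep (map (vec N) xs)

  Simple : RMat → Set
  Simple N = (∀ e → Indep N (e ∷ [])) × (∀ e f → e ≢ f → Indep N (e ∷ f ∷ []))

  Iso : RMat → RMat → Set
  Iso N N' = Σ (G N ↔ G N') λ φ →
    ∀ (xs : List (G N)) → Indep N xs ⇔ Indep N' (map (Inverse.to φ) xs)

  -- X ⊆ E is a flat: for every e ∉ X and every independent I ⊆ X, I ∪ {e} is independent
  -- (equivalently, r(X ∪ e) > r(X) for all e ∉ X, i.e. cl(X) = X).
  Flat : (N : RMat) → (G N → Bool) → Set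
  Flat N X = ∀ e → X e ≡ false → ∀ (I : List (G N)) → All (λ x → X x ≡ true) I →
             Indep N I → Indep N (e ∷ I)

  restrict : (N : RMat) → (G N → Bool) → RMat
  restrict N X = record { G = Σ (G N) (λ e → X e ≡ true) ; r = r N ; vec = λ p → vec N (proj₁ p) }

  -- q-coning: ambient F^r ↪ F^(1+r) (new first coordinate), tip p = (1,0,…,0);
  -- element (e , λ) is the point λp + v(e) (λ = 0 gives the original point e),
  -- so the line through p and v(e) contributes all its q+1 points.
  cone : RMat → RMat
  cone N = record { G = Maybe (G N × Carrier) ; r = suc (r N) ; vec = v' }
    where
      v' : Maybe (G N × Carrier) → Vec Carrier (suc (r N))
      v' nothing        = 1# ∷ replicate (r N) 0#
      v' (just (e , l)) = l ∷ vec N e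

  -- \hat{M}: members of M, closed under repeated q-coning (as a class of matroids,
  -- i.e. up to isomorphism)
  data Hat (M : RMat → Set) : RMat → Set₁ where
    base : ∀ {N} → M N → Hat M N
    cone-step : ∀ {N} → Hat M N → Hat M (cone N)
    iso : ∀ {N N'} → Iso N N' → Hat M N → Hat M N'

  IsSimpleClass : (RMat → Set) → Set₁
  IsSimpleClass M = (∀ N → M N → Simple N) × (∀ N N' → Iso N N' → M N → M N')

  ClosedUnderInducedRestr : ∀ {ℓ} → (RMat → Set ℓ) → Set (Level.suc 0ℓ Level.⊔ ℓ)
  ClosedUnderInducedRestr P = ∀ N (X : G N → Bool) → P N → Flat N X → P (restrict N X)

{-# OPTIONS --safe #-}
-- Induction on the construction of M̂; isomorphisms transport flats and induced restrictions.
-- Let X be a flat of the q-coning of N, with tip p. Flats are closed under linear span, so: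
-- if p ∈ X, then X contains every line through p that it meets, and the restriction to X is the
-- q-coning of the restriction of N to the flat X₀ = {e | (e , 0) ∈ X}; if p ∉ X, then X meets each
-- line through p at most once, and projection from p identifies the restriction to X with the
-- restriction of N to a flat. Finiteness of the field is used only to find the point of X on a line.
module Submission where

open import Defs

open import Level using (0ℓ)
open import Algebra.Bundles using (CommutativeRing)
open import Axiom.UniquenessOfIdentityProofs using (module Decidable⇒UIP)
open import Data.Bool using (Bool; true; false)
import Data.Bool as Bool
open import Data.Bool.Properties using (¬-not; not-¬)
open import Data.Empty using (⊥-elim)
open import Data.Fin using (Fin)
open import Data.Fin.Properties using (any?)
open import Data.List using (List; []; _∷_; map; length)
open import Data.List.Properties using (length-map; map-∘; map-cong)
open import Data.List.Relation.Unary.All as All using (All; []; _∷_)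
import Data.List.Relation.Unary.All.Properties as All
open import Data.List.Relation.Unary.AllPairs using ([]; _∷_)
open import Data.List.Relation.Unary.Unique.Propositional using (Unique)
import Data.List.Relation.Unary.Unique.Propositional.Properties as Unique
open import Data.Maybe using (just; nothing)
open import Data.Nat using (suc; pred)
open import Data.Product using (Σ; ∃; _×_; _,_; proj₁; proj₂)
open import Data.Vec using (Vec; []; _∷_; replicate; zipWith)
import Data.Vec as Vec
open import Data.Vec.Properties using (∷-injectiveˡ; ∷-injectiveʳ; ≡-dec)
open import Function using (_∘_; const)
open import Function.Bundles using (_↔_; _⇔_; Inverse; Injection; mk↔ₛ′; mk⇔; Equivalence)
open import Function.Construct.Composition using (_⇔-∘_)
open import Function.Construct.Symmetry using (⇔-sym)
open import Function.Properties.Inverse using (↔⇒↣)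
open import Relation.Nullary using (Dec; yes; no)
open import Relation.Binary.PropositionalEquality

module Coning (F : FiniteField) where
  open FiniteField F

  private
    commutativeRing : CommutativeRing 0ℓ 0ℓ
    commutativeRing = record { isCommutativeRing = isCommutativeRing }

    enum : Carrier ↔ Fin (proj₁ finite)
    enum = proj₂ finite

  open CommutativeRing commutativeRing
    using (_-_; ring; +-identityˡ; +-identityʳ; *-identityˡ; *-identityʳ; zeroˡ; zeroʳ;
           -‿inverseˡ; -‿inverseʳ; +-assoc; *-assoc; *-comm; distribʳ)
  open import Algebra.Properties.Ring ring
    using (-0#≈0#; -‿involutive; +-inverseʳ-unique; -‿distribˡ-*; -‿distribʳ-*;
           x[y-z]≈xy-xz; x∙y⁻¹≈ε⇒x≈y; //-rightDividesˡ)

  x*y≡0⇒y≡0 : ∀ {x y} → x ≢ 0# → x * y ≡ 0# → y ≡ 0#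
  x*y≡0⇒y≡0 {x} {y} x≢0 xy≡0 with inverse x x≢0
  ... | x⁻¹ , xx⁻¹≡1 = begin
    y               ≡⟨ sym (*-identityˡ y) ⟩
    1# * y          ≡⟨ cong (_* y) (trans (sym xx⁻¹≡1) (*-comm x x⁻¹)) ⟩
    (x⁻¹ * x) * y   ≡⟨ *-assoc x⁻¹ x y ⟩
    x⁻¹ * (x * y)   ≡⟨ cong (x⁻¹ *_) xy≡0 ⟩
    x⁻¹ * 0#        ≡⟨ zeroʳ x⁻¹ ⟩
    0#              ∎
    where open ≡-Reasoning

  x*y≡0⇒x≡0 : ∀ {x y} → y ≢ 0# → x * y ≡ 0# → x ≡ 0#
  x*y≡0⇒x≡0 {x} {y} y≢0 xy≡0 = x*y≡0⇒y≡0 y≢0 (trans (*-comm y x) xy≡0)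

  -1≢0 : - 1# ≢ 0#
  -1≢0 -1≡0 = 0≢1 (sym (begin
    1#        ≡⟨ sym (-‿involutive 1#) ⟩
    - (- 1#)  ≡⟨ cong -_ -1≡0 ⟩
    - 0#      ≡⟨ -0#≈0# ⟩
    0#        ∎))
    where open ≡-Reasoning

  linear-solvable : ∀ {c} → c ≢ 0# → ∀ μ → ∃ λ x → c * x + μ ≡ 0#
  linear-solvable {c} c≢0 μ with inverse c c≢0
  ... | c⁻¹ , cc⁻¹≡1 = - (c⁻¹ * μ) , (begin
    c * - (c⁻¹ * μ) + μ   ≡⟨ cong (_+ μ) (sym (-‿distribʳ-* c (c⁻¹ * μ))) ⟩
    - (c * (c⁻¹ * μ)) + μ ≡⟨ cong (λ x → - x + μ) (sym (*-assoc c c⁻¹ μ)) ⟩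
    - ((c * c⁻¹) * μ) + μ ≡⟨ cong (λ x → - (x * μ) + μ) cc⁻¹≡1 ⟩
    - (1# * μ) + μ        ≡⟨ cong (λ x → - x + μ) (*-identityˡ μ) ⟩
    - μ + μ               ≡⟨ -‿inverseˡ μ ⟩
    0#                    ∎)
    where open ≡-Reasoning

  a*l+[-a*μ+0]≡a*[l-μ] : ∀ a l μ → a * l + (- a * μ + 0#) ≡ a * (l - μ)
  a*l+[-a*μ+0]≡a*[l-μ] a l μ = begin
    a * l + (- a * μ + 0#) ≡⟨ cong (a * l +_) (+-identityʳ (- a * μ)) ⟩
    a * l + - a * μ        ≡⟨ cong (a * l +_) (sym (-‿distribˡ-* a μ)) ⟩
    a * l - a * μ          ≡⟨ sym (x[y-z]≈xy-xz a l μ) ⟩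
    a * (l - μ)            ∎
    where open ≡-Reasoning

  choose : (P : Carrier → Bool) → Σ Carrier λ a → ∀ b → P b ≡ true → P a ≡ true
  choose P with any? (λ i → P (Inverse.from enum i) Bool.≟ true)
  ... | yes (i , Pi) = Inverse.from enum i , λ _ _ → Pi
  ... | no ¬∃ = 0# , λ b Pb → ⊥-elim (¬∃ (Inverse.to enum b ,
                  subst (λ x → P x ≡ true) (sym (Inverse.strictlyInverseʳ enum b)) Pb))

  -- The vector lemmas below are stated in the shapes into which lincomb F (c ∷ cs) (v ∷ vs)
  -- unfolds, namely c · v ⊕ lincomb F cs vs, ending in 0ᵛ.
  infixl 6 _⊕_
  infixr 7 _·_

  _⊕_ : ∀ {n} → Vec Carrier n → Vec Carrier n → Vec Carrier n
  _⊕_ = zipWith _+_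

  _·_ : ∀ {n} → Carrier → Vec Carrier n → Vec Carrier n
  a · v = Vec.map (a *_) v

  0ᵛ : ∀ {n} → Vec Carrier n
  0ᵛ = replicate _ 0#

  _≟ᵛ_ : ∀ {n} (v w : Vec Carrier n) → Dec (v ≡ w)
  _≟ᵛ_ = ≡-dec _≟_

  0·v⊕w≡w : ∀ {n} (v w : Vec Carrier n) → 0# · v ⊕ w ≡ w
  0·v⊕w≡w []      []      = refl
  0·v⊕w≡w (x ∷ v) (y ∷ w) = cong₂ _∷_ (trans (cong (_+ y) (zeroˡ x)) (+-identityˡ y)) (0·v⊕w≡w v w)

  a·0⊕w≡w : ∀ {n} a (w : Vec Carrier n) → a · 0ᵛ ⊕ w ≡ w
  a·0⊕w≡w a []      = refl
  a·0⊕w≡w a (y ∷ w) = cong₂ _∷_ (trans (cong (_+ y) (zeroʳ a)) (+-identityˡ y)) (a·0⊕w≡w a w)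

  1·v⊕0≡v : ∀ {n} (v : Vec Carrier n) → 1# · v ⊕ 0ᵛ ≡ v
  1·v⊕0≡v []      = refl
  1·v⊕0≡v (x ∷ v) = cong₂ _∷_ (trans (+-identityʳ (1# * x)) (*-identityˡ x)) (1·v⊕0≡v v)

  a·v⊕b·v⊕w≡[a+b]·v⊕w : ∀ {n} a b (v w : Vec Carrier n) → a · v ⊕ (b · v ⊕ w) ≡ (a + b) · v ⊕ w
  a·v⊕b·v⊕w≡[a+b]·v⊕w a b []      []      = refl
  a·v⊕b·v⊕w≡[a+b]·v⊕w a b (x ∷ v) (y ∷ w) =
    cong₂ _∷_ (trans (sym (+-assoc (a * x) (b * x) y)) (cong (_+ y) (sym (distribʳ x a b))))
              (a·v⊕b·v⊕w≡[a+b]·v⊕w a b v w)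

  a+b≡0⇒a·v⊕b·v⊕0≡0 : ∀ {n a b} (v : Vec Carrier n) → a + b ≡ 0# → a · v ⊕ (b · v ⊕ 0ᵛ) ≡ 0ᵛ
  a+b≡0⇒a·v⊕b·v⊕0≡0 {a = a} {b} v a+b≡0 = begin
    a · v ⊕ (b · v ⊕ 0ᵛ) ≡⟨ a·v⊕b·v⊕w≡[a+b]·v⊕w a b v 0ᵛ ⟩
    (a + b) · v ⊕ 0ᵛ     ≡⟨ cong (λ c → c · v ⊕ 0ᵛ) a+b≡0 ⟩
    0# · v ⊕ 0ᵛ          ≡⟨ 0·v⊕w≡w v 0ᵛ ⟩
    0ᵛ                   ∎
    where open ≡-Reasoning

  c·v⊕0≡0⇒v≡0 : ∀ {n c} {v : Vec Carrier n} → c ≢ 0# → c · v ⊕ 0ᵛ ≡ 0ᵛ → v ≡ 0ᵛ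
  c·v⊕0≡0⇒v≡0 {v = []}    c≢0 _     = refl
  c·v⊕0≡0⇒v≡0 {v = x ∷ v} c≢0 cv≡0 =
    cong₂ _∷_ (x*y≡0⇒y≡0 c≢0 (trans (sym (+-identityʳ _)) (∷-injectiveˡ cv≡0)))
              (c·v⊕0≡0⇒v≡0 c≢0 (∷-injectiveʳ cv≡0))

  dot : List Carrier → List Carrier → Carrier
  dot []       _        = 0#
  dot (_ ∷ _)  []       = 0#
  dot (c ∷ cs) (x ∷ xs) = c * x + dot cs xs

  dot-zeroˡ : ∀ {cs} xs → All (_≡ 0#) cs → dot cs xs ≡ 0#
  dot-zeroˡ xs       []          = refl
  dot-zeroˡ []       (_ ∷ _)     = refl
  dot-zeroˡ (x ∷ xs) (refl ∷ zs) = trans (cong₂ _+_ (zeroˡ x) (dot-zeroˡ xs zs)) (+-identityʳ 0#)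

  lincomb-∷ : ∀ {A : Set} {n} (h : A → Carrier) (w : A → Vec Carrier n) cs xs →
              lincomb F cs (map (λ a → h a ∷ w a) xs) ≡ dot cs (map h xs) ∷ lincomb F cs (map w xs)
  lincomb-∷ h w []       xs       = refl
  lincomb-∷ h w (c ∷ cs) []       = refl
  lincomb-∷ h w (c ∷ cs) (x ∷ xs) = cong (c · (h x ∷ w x) ⊕_) (lincomb-∷ h w cs xs)

  length-map-irrelevant : ∀ {A B C : Set} (f : A → B) (g : A → C) xs →
                          length (map f xs) ≡ length (map g xs)
  length-map-irrelevant f g xs = trans (length-map f xs) (sym (length-map g xs))

  singleton-LinIndep : ∀ {n} {v : Vec Carrier n} → v ≢ 0ᵛ → LinIndep F (v ∷ [])
  singleton-LinIndep v≢0 (c ∷ []) _ cv≡0 with c ≟ 0#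
  ... | yes c≡0 = c≡0 ∷ []
  ... | no c≢0  = ⊥-elim (v≢0 (c·v⊕0≡0⇒v≡0 c≢0 cv≡0))

  pair-LinIndep : ∀ {n l μ} {v : Vec Carrier n} → l ≢ μ → v ≢ 0ᵛ →
                  LinIndep F ((l ∷ v) ∷ (μ ∷ v) ∷ [])
  pair-LinIndep {l = l} {μ} {v} l≢μ v≢0 (a ∷ b ∷ []) _ comb≡0 = a≡0 ∷ b≡0 ∷ []
    where
      open ≡-Reasoning
      a+b≡0 : a + b ≡ 0#
      a+b≡0 = All.head (singleton-LinIndep v≢0 (a + b ∷ []) refl
                (trans (sym (a·v⊕b·v⊕w≡[a+b]·v⊕w a b v 0ᵛ)) (∷-injectiveʳ comb≡0)))
      b≡-a : b ≡ - a
      b≡-a = +-inverseʳ-unique a b a+b≡0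
      a≡0 : a ≡ 0#
      a≡0 = x*y≡0⇒x≡0 (l≢μ ∘ x∙y⁻¹≈ε⇒x≈y l μ) (begin
        a * (l - μ)            ≡⟨ sym (a*l+[-a*μ+0]≡a*[l-μ] a l μ) ⟩
        a * l + (- a * μ + 0#) ≡⟨ cong (λ x → a * l + (x * μ + 0#)) (sym b≡-a) ⟩
        a * l + (b * μ + 0#)   ≡⟨ ∷-injectiveˡ comb≡0 ⟩
        0#                     ∎)
      b≡0 : b ≡ 0#
      b≡0 = trans b≡-a (trans (cong -_ a≡0) -0#≈0#)

  tip : ∀ {n} → Vec Carrier (suc n)
  tip = 1# ∷ 0ᵛ

  tip-LinIndep : ∀ {n} → LinIndep F (tip {n} ∷ [])
  tip-LinIndep = singleton-LinIndep (0≢1 ∘ sym ∘ ∷-injectiveˡ)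

  LinIndep-lift : ∀ {A : Set} {n} (h : A → Carrier) (w : A → Vec Carrier n) xs →
                  LinIndep F (map w xs) → LinIndep F (map (λ a → h a ∷ w a) xs)
  LinIndep-lift h w xs indep cs len comb≡0 =
    indep cs (trans len (length-map-irrelevant _ w xs))
             (∷-injectiveʳ (trans (sym (lincomb-∷ h w cs xs)) comb≡0))

  tip∷-LinIndep : ∀ {A : Set} {n} (h : A → Carrier) (w : A → Vec Carrier n) xs →
                  LinIndep F (map w xs) ⇔ LinIndep F (tip ∷ map (λ a → h a ∷ w a) xs)
  tip∷-LinIndep h w xs = mk⇔ extend project
    where
      open ≡-Reasoning
      lifted = map (λ a → h a ∷ w a) xs

      extend : LinIndep F (map w xs) → LinIndep F (tip ∷ lifted)
      extend indep (a ∷ cs) len comb≡0 = a≡0 ∷ cs≡0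
        where
          split : (a * 1# + dot cs (map h xs)) ∷ (a · 0ᵛ ⊕ lincomb F cs (map w xs)) ≡ 0# ∷ 0ᵛ
          split = trans (sym (cong (a · tip ⊕_) (lincomb-∷ h w cs xs))) comb≡0
          cs≡0 : All (_≡ 0#) cs
          cs≡0 = indep cs (trans (cong pred len) (length-map-irrelevant _ w xs))
                          (trans (sym (a·0⊕w≡w a _)) (∷-injectiveʳ split))
          a≡0 : a ≡ 0#
          a≡0 = begin
            a                            ≡⟨ sym (*-identityʳ a) ⟩
            a * 1#                       ≡⟨ sym (+-identityʳ (a * 1#)) ⟩
            a * 1# + 0#                  ≡⟨ cong (a * 1# +_) (sym (dot-zeroˡ (map h xs) cs≡0)) ⟩
            a * 1# + dot cs (map h xs)   ≡⟨ ∷-injectiveˡ split ⟩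
            0#                           ∎

      project : LinIndep F (tip ∷ lifted) → LinIndep F (map w xs)
      project indep cs len comb≡0 =
        All.tail (indep (- μ ∷ cs) (cong suc (trans len (length-map-irrelevant w _ xs))) dependency)
        where
          μ = dot cs (map h xs)
          dependency : - μ · tip ⊕ lincomb F cs lifted ≡ 0ᵛ
          dependency = begin
            - μ · tip ⊕ lincomb F cs lifted
              ≡⟨ cong (- μ · tip ⊕_) (lincomb-∷ h w cs xs) ⟩
            (- μ * 1# + μ) ∷ (- μ · 0ᵛ ⊕ lincomb F cs (map w xs))
              ≡⟨ cong₂ _∷_ (trans (cong (_+ μ) (*-identityʳ (- μ))) (-‿inverseˡ μ))
                           (trans (a·0⊕w≡w (- μ) _) comb≡0) ⟩
            0ᵛ ∎

  private
    module BoolUIP = Decidable⇒UIP Bool._≟_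

  restrict-≡ : ∀ {A : Set} {P : A → Bool} {x y : Σ A (λ a → P a ≡ true)} →
               proj₁ x ≡ proj₁ y → x ≡ y
  restrict-≡ {x = a , p} {.a , q} refl = cong (a ,_) (BoolUIP.≡-irrelevant p q)

  Unique×LinIndep-map : ∀ {A B : Set} {n} {vA : A → Vec Carrier n} {vB : B → Vec Carrier n}
                        (f : A → B) → (∀ {x y} → f x ≡ f y → x ≡ y) → (∀ x → vB (f x) ≡ vA x) →
                        ∀ xs → (Unique xs × LinIndep F (map vA xs)) ⇔
                               (Unique (map f xs) × LinIndep F (map vB (map f xs)))
  Unique×LinIndep-map {vA = vA} {vB} f f-injective vB∘f≗vA xs = mk⇔
    (λ (u , indep) → Unique.map⁺ f-injective u , subst (LinIndep F) vectors indep)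
    (λ (u , indep) → Unique.map⁻ u , subst (LinIndep F) (sym vectors) indep)
    where
      vectors : map vA xs ≡ map vB (map f xs)
      vectors = trans (map-cong (sym ∘ vB∘f≗vA) xs) (map-∘ xs)

  Indep-restrict : ∀ N X xs → Indep F (restrict F N X) xs ⇔ Indep F N (map proj₁ xs)
  Indep-restrict N X = Unique×LinIndep-map proj₁ restrict-≡ (λ _ → refl)

  Iso-restrict-along : ∀ {N N' : RMat F} {Y X} (f : G N → G N')
                       (φ : G (restrict F N Y) ↔ G (restrict F N' X)) →
                       (∀ x → proj₁ (Inverse.to φ x) ≡ f (proj₁ x)) →
                       (∀ I → All (λ e → Y e ≡ true) I → Indep F N I ⇔ Indep F N' (map f I)) →
                       Iso F (restrict F N Y) (restrict F N' X)
  Iso-restrict-along {N} {N'} {Y} {X} f φ φ-over-f f-indep = φ , λ xs →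
    ⇔-sym (Indep-restrict N' X (map to xs)) ⇔-∘
      (subst (λ I → Indep F N (map proj₁ xs) ⇔ Indep F N' I) (underlying xs)
             (f-indep (map proj₁ xs) (All.map⁺ (All.universal proj₂ xs)))
      ⇔-∘ Indep-restrict N Y xs)
    where
      open Inverse φ using (to)
      underlying : ∀ xs → map f (map proj₁ xs) ≡ map proj₁ (map to xs)
      underlying xs = trans (sym (map-∘ xs)) (trans (map-cong (sym ∘ φ-over-f) xs) (map-∘ xs))

  Iso-restrict : ∀ {N N'} (φ : Iso F N N') X →
                 Iso F (restrict F N (X ∘ Inverse.to (proj₁ φ))) (restrict F N' X)
  Iso-restrict (φ , φ-indep) X = Iso-restrict-along to ψ (λ _ → refl) (λ I _ → φ-indep I)
    where
      open Inverse φ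
      ψ : Σ _ (λ e → X (to e) ≡ true) ↔ Σ _ (λ e → X e ≡ true)
      ψ = mk↔ₛ′ (λ (e , p) → to e , p)
                (λ (e , p) → from e , subst (λ x → X x ≡ true) (sym (strictlyInverseˡ e)) p)
                (λ (e , _) → restrict-≡ (strictlyInverseˡ e))
                (λ (e , _) → restrict-≡ (strictlyInverseʳ e))

  Flat-pullback : ∀ {N N'} (φ : Iso F N N') {X} → Flat F N' X →
                  Flat F N (X ∘ Inverse.to (proj₁ φ))
  Flat-pullback (φ , φ-indep) flat e e∉X I I⊆X indep =
    Equivalence.from (φ-indep (e ∷ I))
      (flat (to e) e∉X (map to I) (All.map⁺ I⊆X) (Equivalence.to (φ-indep I) indep))
    where open Inverse φ using (to)

  _∈span_ : ∀ {n} → Vec Carrier n → List (Vec Carrier n) → Set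
  v ∈span vs = ∃ λ cs → length cs ≡ length vs × lincomb F cs vs ≡ v

  Flat⇒span-closed : ∀ {N X} → Flat F N X → ∀ {e I} → All (λ x → X x ≡ true) I → Indep F N I →
                     vec N e ∈span map (vec N) I → X e ≡ true
  Flat⇒span-closed {N} {X} flat {e} {I} I⊆X indep (cs , len , comb≡v) with X e in X-e
  ... | true  = refl
  ... | false = ⊥-elim (-1≢0 (All.head
                  (proj₂ (flat e X-e I I⊆X indep) (- 1# ∷ cs) (cong suc len) dependency)))
    where
      open ≡-Reasoning
      dependency : - 1# · vec N e ⊕ lincomb F cs (map (vec N) I) ≡ 0ᵛ
      dependency = begin
        - 1# · vec N e ⊕ lincomb F cs (map (vec N) I)
          ≡⟨ cong (- 1# · vec N e ⊕_) (trans comb≡v (sym (1·v⊕0≡v (vec N e)))) ⟩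
        - 1# · vec N e ⊕ (1# · vec N e ⊕ 0ᵛ)
          ≡⟨ a+b≡0⇒a·v⊕b·v⊕0≡0 (vec N e) (-‿inverseˡ 1#) ⟩
        0ᵛ ∎

  module ConeFlat (N : RMat F) (X : G (cone F N) → Bool) (flat : Flat F (cone F N) X) where
    private
      C = cone F N
      v = vec N

    lift : (G N → Carrier) → G N → G C
    lift h e = just (e , h e)

    lift-Indep : ∀ h {I} → Indep F N I → Indep F C (map (lift h) I)
    lift-Indep h {I} (u , indep) =
      Unique.map⁺ (λ { refl → refl }) u , subst (LinIndep F) (map-∘ I) (LinIndep-lift h v I indep)

    tip∈X⇒line⊆X : X nothing ≡ true → ∀ {e l} →
                   X (just (e , l)) ≡ true → ∀ μ → X (just (e , μ)) ≡ true
    tip∈X⇒line⊆X tip∈X {e} {l} el∈X μ with v e ≟ᵛ 0ᵛ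
    ... | yes v≡0 = Flat⇒span-closed flat (tip∈X ∷ []) (([] ∷ []) , tip-LinIndep)
                      (μ ∷ [] , refl , cong₂ _∷_ μ*1+0≡μ (trans (a·0⊕w≡w μ 0ᵛ) (sym v≡0)))
      where
        μ*1+0≡μ : μ * 1# + 0# ≡ μ
        μ*1+0≡μ = trans (+-identityʳ (μ * 1#)) (*-identityʳ μ)
    ... | no v≢0  = Flat⇒span-closed flat (tip∈X ∷ el∈X ∷ [])
                      ((((λ ()) ∷ []) ∷ [] ∷ []) ,
                       Equivalence.to (tip∷-LinIndep (const l) v (e ∷ [])) (singleton-LinIndep v≢0))
                      ((μ - l) ∷ 1# ∷ [] , refl ,
                       cong₂ _∷_ head≡μ (trans (a·0⊕w≡w _ _) (1·v⊕0≡v (v e))))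
      where
        head≡μ : (μ - l) * 1# + (1# * l + 0#) ≡ μ
        head≡μ = trans (cong₂ _+_ (*-identityʳ (μ - l)) (trans (+-identityʳ (1# * l)) (*-identityˡ l)))
                       (//-rightDividesˡ l μ)

    tip∉X⇒line∩X-unique : X nothing ≡ false → ∀ {e l μ} →
                          X (just (e , l)) ≡ true → X (just (e , μ)) ≡ true → l ≡ μ
    tip∉X⇒line∩X-unique tip∉X {e} {l} {μ} el∈X eμ∈X with l ≟ μ
    ... | yes l≡μ = l≡μ
    ... | no l≢μ  = ⊥-elim (not-¬ tip∈X tip∉X)
      where
        parallel-to-tip : v e ≡ 0ᵛ → ∀ {a} → a ≢ 0# → X (just (e , a)) ≡ true → X nothing ≡ true
        parallel-to-tip v≡0 {a} a≢0 ea∈X with inverse a a≢0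
        ... | a⁻¹ , aa⁻¹≡1 =
          Flat⇒span-closed flat (ea∈X ∷ []) (([] ∷ []) , singleton-LinIndep (a≢0 ∘ ∷-injectiveˡ))
            (a⁻¹ ∷ [] , refl ,
             cong₂ _∷_ (trans (+-identityʳ (a⁻¹ * a)) (trans (*-comm a⁻¹ a) aa⁻¹≡1))
                       (trans (cong (λ w → a⁻¹ · w ⊕ 0ᵛ) v≡0) (a·0⊕w≡w a⁻¹ 0ᵛ)))

        tip∈X : X nothing ≡ true
        tip∈X with v e ≟ᵛ 0ᵛ | l ≟ 0#
        ... | yes v≡0 | yes l≡0 = parallel-to-tip v≡0 (λ μ≡0 → l≢μ (trans l≡0 (sym μ≡0))) eμ∈X
        ... | yes v≡0 | no l≢0  = parallel-to-tip v≡0 l≢0 el∈X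
        ... | no v≢0  | _ with inverse (l - μ) (l≢μ ∘ x∙y⁻¹≈ε⇒x≈y l μ)
        ...   | c , [l-μ]c≡1 =
          Flat⇒span-closed flat (el∈X ∷ eμ∈X ∷ [])
            (((λ { refl → l≢μ refl }) ∷ []) ∷ [] ∷ [] , pair-LinIndep l≢μ v≢0)
            (c ∷ - c ∷ [] , refl ,
             cong₂ _∷_ (trans (a*l+[-a*μ+0]≡a*[l-μ] c l μ) (trans (*-comm c (l - μ)) [l-μ]c≡1))
                       (a+b≡0⇒a·v⊕b·v⊕0≡0 (v e) (-‿inverseʳ c)))

    -- Given a dependency c·v(e) + Σ cᵢ v(xᵢ) = 0 with c ≠ 0, choosing λ₀ with c λ₀ + Σ cᵢ h(xᵢ) = 0
    -- turns it into a dependency of the lifted points, contradicting flatness at (e , λ₀).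
    section-Flat : (h : G N → Carrier) → (∀ e μ → X (just (e , μ)) ≡ true → X (lift h e) ≡ true) →
                   Flat F N (X ∘ lift h)
    section-Flat h h-meets e e∉Y I I⊆Y (u , indep) =
      (All.map (λ x∈Y → λ { refl → not-¬ x∈Y e∉Y }) I⊆Y ∷ u) , linIndep
      where
        linIndep : LinIndep F (map v (e ∷ I))
        linIndep (c ∷ cs) len comb≡0 with c ≟ 0#
        ... | yes c≡0 = c≡0 ∷ indep cs (cong pred len)
                          (trans (sym (0·v⊕w≡w (v e) _)) (subst (λ c → c · v e ⊕ _ ≡ 0ᵛ) c≡0 comb≡0))
        ... | no c≢0 with linear-solvable c≢0 (dot cs (map h I))
        ...   | λ₀ , cλ₀+μ≡0 =
          ⊥-elim (c≢0 (All.head (proj₂ (flat (just (e , λ₀)) eλ₀∉X (map (lift h) I) (All.map⁺ I⊆Y)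
                                               (lift-Indep h (u , indep)))
                                        (c ∷ cs) len' dependency)))
          where
            eλ₀∉X : X (just (e , λ₀)) ≡ false
            eλ₀∉X = ¬-not (λ eλ₀∈X → not-¬ (h-meets e λ₀ eλ₀∈X) e∉Y)
            len' : length (c ∷ cs) ≡ suc (length (map (vec C) (map (lift h) I)))
            len' = trans len (cong suc (trans (length-map-irrelevant v (lift h) I)
                                              (sym (length-map (vec C) (map (lift h) I)))))
            dependency : c · (λ₀ ∷ v e) ⊕ lincomb F cs (map (vec C) (map (lift h) I)) ≡ 0ᵛ
            dependency = trans (cong (λ vs → c · (λ₀ ∷ v e) ⊕ lincomb F cs vs) (sym (map-∘ I)))
                               (trans (cong (c · (λ₀ ∷ v e) ⊕_) (lincomb-∷ h v cs I))
                                      (cong₂ _∷_ cλ₀+μ≡0 comb≡0))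

    lift-Indep⇔ : X nothing ≡ false → ∀ h I → All (λ e → X (lift h e) ≡ true) I →
                  Indep F N I ⇔ Indep F C (map (lift h) I)
    lift-Indep⇔ tip∉X h I I⊆Y = mk⇔ (lift-Indep h) λ lifted-indep →
      Unique.map⁻ (proj₁ lifted-indep) ,
      Equivalence.from (tip∷-LinIndep h v I)
        (subst (λ vs → LinIndep F (tip ∷ vs)) (sym (map-∘ I))
               (proj₂ (flat nothing tip∉X (map (lift h) I) (All.map⁺ I⊆Y) lifted-indep)))

    module TipInside (tip∈X : X nothing ≡ true) where
      X₀ : G N → Bool
      X₀ = X ∘ lift (const 0#)

      X₀-Flat : Flat F N X₀
      X₀-Flat = section-Flat (const 0#) λ _ _ eμ∈X → tip∈X⇒line⊆X tip∈X eμ∈X 0#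

      cone-Iso : Iso F (cone F (restrict F N X₀)) (restrict F C X)
      cone-Iso = φ , Unique×LinIndep-map to (Injection.injective (↔⇒↣ φ))
                       λ { nothing → refl ; (just _) → refl }
        where
          to : G (cone F (restrict F N X₀)) → G (restrict F C X)
          to nothing                  = nothing , tip∈X
          to (just ((e , e∈X₀) , l)) = just (e , l) , tip∈X⇒line⊆X tip∈X e∈X₀ l
          from : G (restrict F C X) → G (cone F (restrict F N X₀))
          from (nothing , _)         = nothing
          from (just (e , l) , el∈X) = just ((e , tip∈X⇒line⊆X tip∈X el∈X 0#) , l)
          φ : G (cone F (restrict F N X₀)) ↔ G (restrict F C X)
          φ = mk↔ₛ′ to from (λ { (nothing , _) → restrict-≡ refl ; (just _ , _) → restrict-≡ refl })
                            (λ { nothing → refl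
                               ; (just (_ , l)) → cong (λ p → just (p , l)) (restrict-≡ refl) })

    module TipOutside (tip∉X : X nothing ≡ false) where
      onLine : G N → Carrier
      onLine e = proj₁ (choose (λ l → X (just (e , l))))

      onLine-meets : ∀ e μ → X (just (e , μ)) ≡ true → X (lift onLine e) ≡ true
      onLine-meets e = proj₂ (choose (λ l → X (just (e , l))))

      Y : G N → Bool
      Y = X ∘ lift onLine

      Y-Flat : Flat F N Y
      Y-Flat = section-Flat onLine onLine-meets

      projection-Iso : Iso F (restrict F N Y) (restrict F C X)
      projection-Iso = Iso-restrict-along (lift onLine) φ (λ _ → refl) (lift-Indep⇔ tip∉X onLine)
        where
          from : G (restrict F C X) → G (restrict F N Y)
          from (nothing , tip∈X)     = ⊥-elim (not-¬ tip∈X tip∉X)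
          from (just (e , l) , el∈X) = e , onLine-meets e l el∈X
          φ : G (restrict F N Y) ↔ G (restrict F C X)
          φ = mk↔ₛ′ (λ (e , e∈Y) → lift onLine e , e∈Y) from
                (λ { (nothing , tip∈X) → ⊥-elim (not-¬ tip∈X tip∉X)
                   ; (just (e , l) , el∈X) → restrict-≡ (cong (λ μ → just (e , μ))
                       (tip∉X⇒line∩X-unique tip∉X (onLine-meets e l el∈X) el∈X)) })
                (λ _ → restrict-≡ refl)

lemma3p2 : (F : FiniteField) (M : RMat F → Set) →
           IsSimpleClass F M → ClosedUnderInducedRestr F M →
           ClosedUnderInducedRestr F (Hat F M)
lemma3p2 F M _ M-closed = closed
  where
    open Coning F
    closed : ClosedUnderInducedRestr F (Hat F M)
    closed N X (base N∈M) flat = base (M-closed N X N∈M flat)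
    closed N X (iso φ N∈M̂) flat = iso (Iso-restrict φ X) (closed _ _ N∈M̂ (Flat-pullback φ flat))
    closed _ X (cone-step {N} N∈M̂) flat with X nothing in X-tip
    ... | true  = iso cone-Iso (cone-step (closed N X₀ N∈M̂ X₀-Flat))
      where open ConeFlat N X flat
            open TipInside X-tip
    ... | false = iso projection-Iso (closed N Y N∈M̂ Y-Flat)
      where open ConeFlat N X flat
            open TipOutside X-tip
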